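{- For $p$ an odd prime, $\mathrm{H}(p-1)\equiv (-1)^{\frac{p-1}{2}}\,(p-1)!!\pmod p$.
   Context: For a natural number $n$, the double factorial $n!!$ is the product of the natural numbers less than or equal to $n$ that have the same parity as $n$. The hyperfactorial is $\mathrm{H}(n)=\prod_{k=1}^n k^k$. -}

module Defs where

open import Data.Nat using (ℕ; zero; suc; _*_; _^_)

_!! : ℕ → ℕ
zero !! = 1
suc zero !! = 1
suc (suc n) !! = suc (suc n) * (n !!)

H : ℕ → ℕ
H zero = 1
H (suc n) = H n * (suc n ^ suc n)

-- Write p = 2m + 1. In H(p - 1) = ∏ k^k pair k with p - k: as p - k ≡ -k and
-- k^p ≡ k (Fermat), k^k (p - k)^(p - k) ≡ (-1)^(p - k) k^p ≡ (-1)^(k - 1) k, so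
-- H(p - 1) ≡ ∏_{k ≤ m} (-1)^(k - 1) k = (-1)^m ∏_{k ≤ m} (-1)^k k. In the last
-- product the consecutive factors -(2t + 1) and 2t + 2 are congruent to the even
-- numbers p - (2t + 1) and 2t + 2, and these run over all of 2, 4, ..., 2m exactly
-- once (when m is odd the unpaired factor -m is congruent to m + 1), so
-- ∏_{k ≤ m} (-1)^k k ≡ 2 · 4 ⋯ 2m = (p - 1)!!.
module Submission where

open import Defs
open import Level using (0ℓ)
open import Data.Nat.Base as ℕ using (ℕ; zero; suc; _∸_; _<_; _≤_; ⌊_/2⌋; _!; z<s)
open import Data.Nat.Properties as ℕₚ using (_!*_!≢0)
open import Data.Nat.Combinatorics using (_C_; nCn≡1; nCk≡n!/k![n-k]!; k![n∸k]!∣n!)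
open import Data.Nat.DivMod using (_/_; m/n*n≡m)
open import Data.Nat.Divisibility using (divides; ∣⇒≤; ∣1⇒≡1; m∣m*n)
  renaming (_∣_ to _∣ₙ_)
open import Data.Nat.Primality using (Prime; euclidsLemma; prime⇒irreducible; ¬prime[1])
import Data.Nat.Tactic.RingSolver as NatSolver
open import Data.Integer.Base as ℤ using (ℤ; +_; -_; _-_; _+_; _*_; _^_; 0ℤ; 1ℤ; -1ℤ)
import Data.Integer.Properties as ℤₚ
open import Data.Integer.Divisibility using (_∣_)
import Data.Integer.Divisibility.Signed as Signed
open import Data.Integer.Tactic.RingSolver using (solve-∀)
open import Data.Fin.Base using (zero; suc; toℕ; inject₁; fromℕ)
open import Data.Fin.Properties using (toℕ-inject₁; toℕ<n; toℕ-fromℕ)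
open import Data.Vec.Functional using (Vector; tail)
open import Data.Sum.Base using (inj₁; inj₂)
open import Relation.Nullary.Negation using (¬_; contradiction)
open import Relation.Binary.Bundles using (Setoid)
open import Relation.Binary.PropositionalEquality
import Relation.Binary.Reasoning.Setoid as SetoidReasoning
open import Algebra.Properties.Monoid.Sum ℤₚ.+-0-monoid using (sum; sum-init-last; sum-cong-≗)
import Algebra.Properties.CommutativeSemiring.Binomial ℤₚ.+-*-commutativeSemiring as Binomial
open import Algebra.Definitions.RawSemiring ℤ.+-*-rawSemiring
  using (_×_) renaming (_^_ to _^ₛ_)

infix 4 _≡_mod_

record _≡_mod_ (x y : ℤ) (n : ℕ) : Set where
  constructor divides-difference
  field
    difference-divisible : + n Signed.∣ x - y

open _≡_mod_

module _ {n : ℕ} where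

  mod-refl : ∀ {x} → x ≡ x mod n
  mod-refl {x} = divides-difference (Signed.divides 0ℤ (ℤₚ.+-inverseʳ x))

  mod-sym : ∀ {x y} → x ≡ y mod n → y ≡ x mod n
  mod-sym {x} {y} (divides-difference d) =
    divides-difference (subst (+ n Signed.∣_) (negate x y) (Signed.∣m⇒∣-m d))
    where negate : ∀ x y → - (x - y) ≡ y - x
          negate = solve-∀

  mod-trans : ∀ {x y z} → x ≡ y mod n → y ≡ z mod n → x ≡ z mod n
  mod-trans {x} {y} {z} (divides-difference d) (divides-difference e) =
    divides-difference (subst (+ n Signed.∣_) (telescope x y z) (Signed.∣m∣n⇒∣m+n d e))
    where telescope : ∀ x y z → (x - y) + (y - z) ≡ x - z
          telescope = solve-∀

  mod-+ : ∀ {x y u v} → x ≡ y mod n → u ≡ v mod n → x + u ≡ y + v mod n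
  mod-+ {x} {y} {u} {v} (divides-difference d) (divides-difference e) =
    divides-difference (subst (+ n Signed.∣_) (regroup x y u v) (Signed.∣m∣n⇒∣m+n d e))
    where regroup : ∀ x y u v → (x - y) + (u - v) ≡ (x + u) - (y + v)
          regroup = solve-∀

  mod-* : ∀ {x y u v} → x ≡ y mod n → u ≡ v mod n → x * u ≡ y * v mod n
  mod-* {x} {y} {u} {v} (divides-difference d) (divides-difference e) =
    divides-difference (subst (+ n Signed.∣_) (regroup x y u v)
      (Signed.∣m∣n⇒∣m+n (Signed.∣m⇒∣m*n u d) (Signed.∣n⇒∣m*n y e)))
    where regroup : ∀ x y u v → (x - y) * u + y * (u - v) ≡ x * u - y * v
          regroup = solve-∀

  mod-+ˡ : ∀ x {u v} → u ≡ v mod n → x + u ≡ x + v mod n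
  mod-+ˡ x = mod-+ (mod-refl {x})

  mod-+ʳ : ∀ x {u v} → u ≡ v mod n → u + x ≡ v + x mod n
  mod-+ʳ x u≡v = mod-+ u≡v (mod-refl {x})

  mod-*ˡ : ∀ x {u v} → u ≡ v mod n → x * u ≡ x * v mod n
  mod-*ˡ x = mod-* (mod-refl {x})

  mod-*ʳ : ∀ x {u v} → u ≡ v mod n → u * x ≡ v * x mod n
  mod-*ʳ x u≡v = mod-* u≡v (mod-refl {x})

  mod-^ : ∀ {x y} → x ≡ y mod n → ∀ k → x ^ k ≡ y ^ k mod n
  mod-^ x≡y zero    = mod-refl
  mod-^ x≡y (suc k) = mod-* x≡y (mod-^ x≡y k)

  multiple≡0 : ∀ {x} → + n Signed.∣ x → x ≡ 0ℤ mod n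
  multiple≡0 {x} d = divides-difference (subst (+ n Signed.∣_) (sym (ℤₚ.+-identityʳ x)) d)

  complement≡neg : ∀ a {b} → a ℕ.+ b ≡ n → + b ≡ - + a mod n
  complement≡neg a {b} refl =
    divides-difference (subst (+ n Signed.∣_) (sym b+a≡n) Signed.∣-refl)
    where
    b+a≡n : + b - - + a ≡ + (a ℕ.+ b)
    b+a≡n = trans (swap (+ a) (+ b)) (sym (ℤₚ.pos-+ a b))
      where swap : ∀ x y → y - - x ≡ x + y
            swap = solve-∀

  sum≡0 : ∀ {k} (t : Vector ℤ k) → (∀ i → t i ≡ 0ℤ mod n) → sum t ≡ 0ℤ mod n
  sum≡0 {zero}  t t≡0 = mod-refl
  sum≡0 {suc k} t t≡0 = mod-+ (t≡0 zero) (sum≡0 (tail t) (λ i → t≡0 (suc i)))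

mod-setoid : ℕ → Setoid 0ℓ 0ℓ
mod-setoid n = record
  { Carrier       = ℤ
  ; _≈_           = λ x y → x ≡ y mod n
  ; isEquivalence = record { refl = mod-refl ; sym = mod-sym ; trans = mod-trans }
  }

module ≡-mod-Reasoning (n : ℕ) = SetoidReasoning (mod-setoid n)

∏ : ℕ → (ℕ → ℤ) → ℤ
∏ zero    f = 1ℤ
∏ (suc n) f = ∏ n f * f n

syntax ∏ n (λ i → x) = ∏[ i < n ] x

∏-cong : ∀ n {f g} → (∀ {i} → i < n → f i ≡ g i) → ∏ n f ≡ ∏ n g
∏-cong zero    f≡g = refl
∏-cong (suc n) f≡g =
  cong₂ _*_ (∏-cong n (λ i<n → f≡g (ℕₚ.m<n⇒m<1+n i<n))) (f≡g (ℕₚ.n<1+n n))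

∏-cong-mod : ∀ {p} n {f g} → (∀ {i} → i < n → f i ≡ g i mod p) → ∏ n f ≡ ∏ n g mod p
∏-cong-mod zero    f≡g = mod-refl
∏-cong-mod (suc n) f≡g =
  mod-* (∏-cong-mod n (λ i<n → f≡g (ℕₚ.m<n⇒m<1+n i<n))) (f≡g (ℕₚ.n<1+n n))

∏-* : ∀ n f g → ∏[ i < n ] (f i * g i) ≡ ∏ n f * ∏ n g
∏-* zero    f g = refl
∏-* (suc n) f g =
  trans (cong (_* (f n * g n)) (∏-* n f g)) (interchange (∏ n f) (∏ n g) (f n) (g n))
  where interchange : ∀ a b c d → a * b * (c * d) ≡ a * c * (b * d)
        interchange = solve-∀

∏-scale : ∀ n c f → ∏[ i < n ] (c * f i) ≡ c ^ n * ∏ n f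
∏-scale zero    c f = refl
∏-scale (suc n) c f =
  trans (cong (_* (c * f n)) (∏-scale n c f)) (regroup (c ^ n) (∏ n f) c (f n))
  where regroup : ∀ a b c d → a * b * (c * d) ≡ c * a * (b * d)
        regroup = solve-∀

∏-neg : ∀ n f → ∏[ i < n ] (- f i) ≡ -1ℤ ^ n * ∏ n f
∏-neg n f = trans (∏-cong n (λ {i} _ → sym (ℤₚ.-1*i≡-i (f i)))) (∏-scale n -1ℤ f)

∏-+ : ∀ m n f → ∏ (m ℕ.+ n) f ≡ ∏ m f * ∏[ i < n ] f (m ℕ.+ i)
∏-+ m zero    f = trans (cong (λ k → ∏ k f) (ℕₚ.+-identityʳ m)) (sym (ℤₚ.*-identityʳ (∏ m f)))
∏-+ m (suc n) f = begin
  ∏ (m ℕ.+ suc n) f                             ≡⟨ cong (λ k → ∏ k f) (ℕₚ.+-suc m n) ⟩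
  ∏ (m ℕ.+ n) f * f (m ℕ.+ n)                   ≡⟨ cong (_* f (m ℕ.+ n)) (∏-+ m n f) ⟩
  ∏ m f * ∏[ i < n ] f (m ℕ.+ i) * f (m ℕ.+ n)  ≡⟨ ℤₚ.*-assoc (∏ m f) _ _ ⟩
  ∏ m f * ∏[ i < suc n ] f (m ℕ.+ i)            ∎
  where open ≡-Reasoning

∏-reverse : ∀ n f → ∏ n f ≡ ∏[ i < n ] f (n ∸ suc i)
∏-reverse zero    f = refl
∏-reverse (suc n) f = begin
  ∏ n f * f n                       ≡⟨ cong (_* f n) (∏-reverse n f) ⟩
  ∏[ i < n ] f (n ∸ suc i) * f n    ≡⟨ ℤₚ.*-comm _ (f n) ⟩
  f n * ∏[ i < n ] f (n ∸ suc i)    ≡⟨ ∏-shift n (λ i → f (suc n ∸ suc i)) ⟨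
  ∏[ i < suc n ] f (suc n ∸ suc i)  ∎
  where
  open ≡-Reasoning
  ∏-shift : ∀ n g → ∏ (suc n) g ≡ g 0 * ∏[ i < n ] g (suc i)
  ∏-shift zero    g = ℤₚ.*-comm 1ℤ (g 0)
  ∏-shift (suc n) g = trans (cong (_* g (suc n)) (∏-shift n g)) (ℤₚ.*-assoc (g 0) _ _)

∏-pairs : ∀ r f → ∏ (r ℕ.+ r) f ≡ ∏[ t < r ] (f (t ℕ.+ t) * f (suc (t ℕ.+ t)))
∏-pairs zero    f = refl
∏-pairs (suc r) f = begin
  ∏ (suc r ℕ.+ suc r) f                            ≡⟨ cong (λ k → ∏ (suc k) f) (ℕₚ.+-suc r r) ⟩
  ∏ (r ℕ.+ r) f * f (r ℕ.+ r) * f (suc (r ℕ.+ r))  ≡⟨ ℤₚ.*-assoc (∏ (r ℕ.+ r) f) _ _ ⟩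
  ∏ (r ℕ.+ r) f * pair r                           ≡⟨ cong (_* pair r) (∏-pairs r f) ⟩
  ∏[ t < suc r ] pair t                            ∎
  where
  open ≡-Reasoning
  pair : ℕ → ℤ
  pair t = f (t ℕ.+ t) * f (suc (t ℕ.+ t))

∏-fold-even : ∀ r f → ∏ (r ℕ.+ r) f ≡ ∏[ i < r ] (f i * f (r ℕ.+ r ∸ suc i))
∏-fold-even r f = begin
  ∏ (r ℕ.+ r) f                             ≡⟨ ∏-+ r r f ⟩
  ∏ r f * ∏[ i < r ] f (r ℕ.+ i)            ≡⟨ cong (∏ r f *_) (∏-reverse r (λ i → f (r ℕ.+ i))) ⟩
  ∏ r f * ∏[ i < r ] f (r ℕ.+ (r ∸ suc i))  ≡⟨ cong (∏ r f *_) (∏-cong r mirror) ⟨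
  ∏ r f * ∏[ i < r ] f (r ℕ.+ r ∸ suc i)    ≡⟨ ∏-* r f (λ i → f (r ℕ.+ r ∸ suc i)) ⟨
  ∏[ i < r ] (f i * f (r ℕ.+ r ∸ suc i))    ∎
  where
  open ≡-Reasoning
  mirror : ∀ {i} → i < r → f (r ℕ.+ r ∸ suc i) ≡ f (r ℕ.+ (r ∸ suc i))
  mirror i<r = cong f (ℕₚ.+-∸-assoc r i<r)

∏-fold-odd : ∀ r f → ∏ (suc (r ℕ.+ r)) f ≡ ∏[ i < r ] (f i * f (r ℕ.+ r ∸ i)) * f r
∏-fold-odd r f = begin
  ∏ (suc (r ℕ.+ r)) f                          ≡⟨ cong (λ k → ∏ k f) (ℕₚ.+-suc r r) ⟨
  ∏ (r ℕ.+ suc r) f                            ≡⟨ ∏-+ r (suc r) f ⟩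
  ∏ r f * ∏[ i < suc r ] f (r ℕ.+ i)
    ≡⟨ cong (∏ r f *_) (∏-reverse (suc r) (λ i → f (r ℕ.+ i))) ⟩
  ∏ r f * (∏[ i < r ] f (r ℕ.+ (r ∸ i)) * f (r ℕ.+ (r ∸ r)))
    ≡⟨ cong₂ (λ a b → ∏ r f * (a * b)) (∏-cong r mirror) (cong f middle) ⟨
  ∏ r f * (∏[ i < r ] f (r ℕ.+ r ∸ i) * f r)   ≡⟨ ℤₚ.*-assoc (∏ r f) _ _ ⟨
  ∏ r f * ∏[ i < r ] f (r ℕ.+ r ∸ i) * f r     ≡⟨ cong (_* f r) (∏-* r f (λ i → f (r ℕ.+ r ∸ i))) ⟨
  ∏[ i < r ] (f i * f (r ℕ.+ r ∸ i)) * f r     ∎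
  where
  open ≡-Reasoning
  mirror : ∀ {i} → i < r → f (r ℕ.+ r ∸ i) ≡ f (r ℕ.+ (r ∸ i))
  mirror i<r = cong f (ℕₚ.+-∸-assoc r (ℕₚ.<⇒≤ i<r))
  middle : r ≡ r ℕ.+ (r ∸ r)
  middle = sym (trans (cong (r ℕ.+_) (ℕₚ.n∸n≡0 r)) (ℕₚ.+-identityʳ r))

pos-^ : ∀ a k → + (a ℕ.^ k) ≡ (+ a) ^ k
pos-^ a zero    = refl
pos-^ a (suc k) = trans (ℤₚ.pos-* a (a ℕ.^ k)) (cong (+ a *_) (pos-^ a k))

neg-^ : ∀ x k → (- x) ^ k ≡ -1ℤ ^ k * x ^ k
neg-^ x zero    = refl
neg-^ x (suc k) = trans (cong (- x *_) (neg-^ x k)) (regroup x (-1ℤ ^ k) (x ^ k))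
  where regroup : ∀ x s y → - x * (s * y) ≡ -1ℤ * s * (x * y)
        regroup = solve-∀

-1^[n+n]≡1 : ∀ n → -1ℤ ^ (n ℕ.+ n) ≡ 1ℤ
-1^[n+n]≡1 zero    = refl
-1^[n+n]≡1 (suc n) = begin
  -1ℤ ^ suc (n ℕ.+ suc n)        ≡⟨ cong (λ k → -1ℤ ^ suc k) (ℕₚ.+-suc n n) ⟩
  -1ℤ * (-1ℤ * -1ℤ ^ (n ℕ.+ n))  ≡⟨ cong (λ s → -1ℤ * (-1ℤ * s)) (-1^[n+n]≡1 n) ⟩
  1ℤ                             ∎
  where open ≡-Reasoning

-1^-odd-sum : ∀ a b c → a ℕ.+ b ≡ suc (c ℕ.+ c) → -1ℤ ^ b ≡ - (-1ℤ ^ a)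
-1^-odd-sum a b c a+b≡odd = begin
  -1ℤ ^ b                            ≡⟨ ℤₚ.*-identityˡ (-1ℤ ^ b) ⟨
  1ℤ * -1ℤ ^ b                       ≡⟨ cong (_* -1ℤ ^ b) square≡1 ⟨
  -1ℤ ^ a * -1ℤ ^ a * -1ℤ ^ b        ≡⟨ ℤₚ.*-assoc (-1ℤ ^ a) _ _ ⟩
  -1ℤ ^ a * (-1ℤ ^ a * -1ℤ ^ b)      ≡⟨ cong (-1ℤ ^ a *_) (ℤₚ.^-distribˡ-+-* -1ℤ a b) ⟨
  -1ℤ ^ a * -1ℤ ^ (a ℕ.+ b)          ≡⟨ cong (λ k → -1ℤ ^ a * -1ℤ ^ k) a+b≡odd ⟩
  -1ℤ ^ a * (-1ℤ * -1ℤ ^ (c ℕ.+ c))  ≡⟨ cong (λ s → -1ℤ ^ a * (-1ℤ * s)) (-1^[n+n]≡1 c) ⟩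
  -1ℤ ^ a * -1ℤ                      ≡⟨ times-1 (-1ℤ ^ a) ⟩
  - (-1ℤ ^ a)                        ∎
  where
  open ≡-Reasoning
  square≡1 : -1ℤ ^ a * -1ℤ ^ a ≡ 1ℤ
  square≡1 = trans (sym (ℤₚ.^-distribˡ-+-* -1ℤ a a)) (-1^[n+n]≡1 a)
  times-1 : ∀ x → x * -1ℤ ≡ - x
  times-1 = solve-∀

prime∤! : ∀ {p} → Prime p → ∀ {k} → k < p → ¬ p ∣ₙ k !
prime∤! pr {zero}  _   p∣1  = ¬prime[1] (subst Prime (∣1⇒≡1 p∣1) pr)
prime∤! pr {suc k} k<p p∣k! with euclidsLemma (suc k) (k !) pr p∣k!
... | inj₁ p∣1+k = ℕₚ.<⇒≱ k<p (∣⇒≤ p∣1+k)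
... | inj₂ p∣k!′ = prime∤! pr (ℕₚ.<⇒≤ k<p) p∣k!′

C*k!*[n∸k]!≡n! : ∀ {n k} → k ≤ n → (n C k) ℕ.* (k ! ℕ.* (n ∸ k) !) ≡ n !
C*k!*[n∸k]!≡n! {n} {k} k≤n = begin
  (n C k) ℕ.* d         ≡⟨ cong (ℕ._* d) (nCk≡n!/k![n-k]! k≤n) ⟩
  n ! / d ℕ.* d         ≡⟨ m/n*n≡m (k![n∸k]!∣n! k≤n) ⟩
  n !                   ∎
  where
  open ≡-Reasoning
  d : ℕ
  d = k ! ℕ.* (n ∸ k) !
  instance
    d≢0 : ℕ.NonZero d
    d≢0 = k !* (n ∸ k) !≢0

prime∣C : ∀ {p k} → Prime p → 0 < k → k < p → p ∣ₙ p C k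
prime∣C {zero} ()
prime∣C {p@(suc n)} {k} pr 0<k k<p
  with euclidsLemma (p C k) (k ! ℕ.* (p ∸ k) !) pr
         (subst (p ∣ₙ_) (sym (C*k!*[n∸k]!≡n! (ℕₚ.<⇒≤ k<p))) (m∣m*n (n !)))
... | inj₁ p∣C = p∣C
... | inj₂ p∣k!*[p∸k]! with euclidsLemma (k !) ((p ∸ k) !) pr p∣k!*[p∸k]!
...   | inj₁ p∣k!     = contradiction p∣k! (prime∤! pr k<p)
...   | inj₂ p∣[p∸k]! =
  contradiction p∣[p∸k]! (prime∤! pr (ℕₚ.∸-monoʳ-< 0<k (ℕₚ.<⇒≤ k<p)))

^ₛ≡^ : ∀ x k → x ^ₛ k ≡ x ^ k
^ₛ≡^ x zero    = refl
^ₛ≡^ x (suc k) = cong (x *_) (^ₛ≡^ x k)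

×≡pos* : ∀ k x → k × x ≡ + k * x
×≡pos* zero    x = refl
×≡pos* (suc k) x = trans (cong (_+_ x) (×≡pos* k x)) (distrib (+ k) x)
  where distrib : ∀ k x → x + k * x ≡ (1ℤ + k) * x
        distrib = solve-∀

frobenius : ∀ {p} → Prime p → ∀ x → (1ℤ + x) ^ p ≡ 1ℤ + x ^ p mod p
frobenius {zero} ()
frobenius {p@(suc n)} pr x = begin
  (1ℤ + x) ^ p                        ≡⟨ ^ₛ≡^ (1ℤ + x) p ⟨
  (1ℤ + x) ^ₛ p                       ≡⟨ Binomial.theorem p 1ℤ x ⟩
  sum (Binomial.binomialTerm 1ℤ x p)  ≡⟨ sum-cong-≗ {suc p} (λ i → binomialTerm≡term (toℕ i)) ⟩
  sum {suc p} (λ i → term (toℕ i))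
    ≡⟨ cong (_+_ (term 0)) (sum-init-last {n} (λ i → term (suc (toℕ i)))) ⟩
  term 0 + (sum middle + term (suc (toℕ (fromℕ n))))
    ≡⟨ cong (λ k → term 0 + (sum middle + term (suc k))) (toℕ-fromℕ n) ⟩
  term 0 + (sum middle + term p)      ≈⟨ mod-+ˡ (term 0) (mod-+ʳ (term p) (sum≡0 middle middle≡0)) ⟩
  term 0 + (0ℤ + term p)              ≡⟨ cong₂ (λ a b → a + (0ℤ + b)) first-term last-term ⟩
  x ^ p + 1ℤ                          ≡⟨ ℤₚ.+-comm (x ^ p) 1ℤ ⟩
  1ℤ + x ^ p                          ∎
  where
  open ≡-mod-Reasoning p
  term : ℕ → ℤ
  term k = + (p C k) * (1ℤ ^ k * x ^ (p ∸ k))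
  binomialTerm≡term : ∀ k → (p C k) × (1ℤ ^ₛ k * x ^ₛ (p ∸ k)) ≡ term k
  binomialTerm≡term k = trans (×≡pos* (p C k) _)
    (cong₂ (λ a b → + (p C k) * (a * b)) (^ₛ≡^ 1ℤ k) (^ₛ≡^ x (p ∸ k)))
  middle : Vector ℤ n
  middle j = term (suc (toℕ (inject₁ j)))
  middle≡0 : ∀ j → middle j ≡ 0ℤ mod p
  middle≡0 j = multiple≡0 (Signed.∣m⇒∣m*n {m = + (p C k)} (1ℤ ^ k * x ^ (p ∸ k))
                                          (Signed.∣ᵤ⇒∣ (prime∣C pr z<s (ℕ.s≤s j<n))))
    where k : ℕ
          k = suc (toℕ (inject₁ j))
          j<n : toℕ (inject₁ j) < n
          j<n = subst (_< n) (sym (toℕ-inject₁ j)) (toℕ<n j)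
  first-term : term 0 ≡ x ^ p
  first-term = trans (ℤₚ.*-identityˡ _) (ℤₚ.*-identityˡ (x ^ p))
  last-term : term p ≡ 1ℤ
  last-term rewrite nCn≡1 p | ℕₚ.n∸n≡0 n =
    trans (ℤₚ.*-identityˡ _) (trans (ℤₚ.*-identityʳ _) (ℤₚ.^-zeroˡ p))

-- + suc a is definitionally 1ℤ + + a.
fermat : ∀ {p} → Prime p → ∀ a → (+ a) ^ p ≡ + a mod p
fermat {zero}  ()
fermat {suc n} pr zero    = mod-refl
fermat {p}     pr (suc a) = begin
  (1ℤ + + a) ^ p  ≈⟨ frobenius pr (+ a) ⟩
  1ℤ + (+ a) ^ p  ≈⟨ mod-+ˡ 1ℤ (fermat pr a) ⟩
  1ℤ + + a        ∎
  where open ≡-mod-Reasoning p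

self-powers-pair : ∀ {p} → Prime p → ∀ a b → a ℕ.+ b ≡ p →
                   (+ a) ^ a * (+ b) ^ b ≡ -1ℤ ^ b * + a mod p
self-powers-pair {p} pr a b a+b≡p = begin
  (+ a) ^ a * (+ b) ^ b              ≈⟨ mod-*ˡ ((+ a) ^ a) (mod-^ (complement≡neg a a+b≡p) b) ⟩
  (+ a) ^ a * (- + a) ^ b            ≡⟨ cong ((+ a) ^ a *_) (neg-^ (+ a) b) ⟩
  (+ a) ^ a * (-1ℤ ^ b * (+ a) ^ b)  ≡⟨ regroup ((+ a) ^ a) (-1ℤ ^ b) ((+ a) ^ b) ⟩
  -1ℤ ^ b * ((+ a) ^ a * (+ a) ^ b)  ≡⟨ cong (-1ℤ ^ b *_) (ℤₚ.^-distribˡ-+-* (+ a) a b) ⟨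
  -1ℤ ^ b * (+ a) ^ (a ℕ.+ b)        ≡⟨ cong (λ k → -1ℤ ^ b * (+ a) ^ k) a+b≡p ⟩
  -1ℤ ^ b * (+ a) ^ p                ≈⟨ mod-*ˡ (-1ℤ ^ b) (fermat pr a) ⟩
  -1ℤ ^ b * + a                      ∎
  where
  open ≡-mod-Reasoning p
  regroup : ∀ x s y → x * (s * y) ≡ s * (x * y)
  regroup = solve-∀

H-as-∏ : ∀ n → + H n ≡ ∏[ i < n ] ((+ suc i) ^ suc i)
H-as-∏ zero    = refl
H-as-∏ (suc n) = trans (ℤₚ.pos-* (H n) _) (cong₂ _*_ (H-as-∏ n) (pos-^ (suc n) (suc n)))

alternating : ℕ → ℤ
alternating i = -1ℤ ^ suc i * + suc i

H≡∏-alternating : ∀ m → Prime (suc (m ℕ.+ m)) →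
                  + H (m ℕ.+ m) ≡ ∏[ i < m ] (- alternating i) mod suc (m ℕ.+ m)
H≡∏-alternating m pr = begin
  + H (m ℕ.+ m)                                             ≡⟨ H-as-∏ (m ℕ.+ m) ⟩
  ∏ (m ℕ.+ m) self-power                                    ≡⟨ ∏-fold-even m self-power ⟩
  ∏[ i < m ] (self-power i * self-power (m ℕ.+ m ∸ suc i))  ≈⟨ ∏-cong-mod m pair ⟩
  ∏[ i < m ] (- alternating i)                              ∎
  where
  open ≡-mod-Reasoning (suc (m ℕ.+ m))
  self-power : ℕ → ℤ
  self-power i = (+ suc i) ^ suc i
  pair : ∀ {i} → i < m →
         self-power i * self-power (m ℕ.+ m ∸ suc i) ≡ - alternating i mod suc (m ℕ.+ m)
  pair {i} i<m = begin
    self-power i * self-power j  ≈⟨ self-powers-pair pr (suc i) (suc j) complementary ⟩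
    -1ℤ ^ suc j * + suc i        ≡⟨ cong (_* + suc i) (-1^-odd-sum (suc i) (suc j) m complementary) ⟩
    - (-1ℤ ^ suc i) * + suc i    ≡⟨ ℤₚ.neg-distribˡ-* (-1ℤ ^ suc i) (+ suc i) ⟨
    - alternating i              ∎
    where
    j : ℕ
    j = m ℕ.+ m ∸ suc i
    complementary : suc i ℕ.+ suc j ≡ suc (m ℕ.+ m)
    complementary = trans (ℕₚ.+-suc (suc i) j)
      (cong suc (ℕₚ.m+[n∸m]≡n (ℕₚ.≤-trans i<m (ℕₚ.m≤m+n m m))))

even-number : ℕ → ℤ
even-number i = + (suc i ℕ.+ suc i)

!!-as-∏ : ∀ m → + ((m ℕ.+ m) !!) ≡ ∏[ i < m ] even-number i
!!-as-∏ zero    = refl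
!!-as-∏ (suc m) = begin
  + ((suc m ℕ.+ suc m) !!)                  ≡⟨ cong (λ k → + (suc k !!)) (ℕₚ.+-suc m m) ⟩
  + (suc (suc (m ℕ.+ m)) ℕ.* (m ℕ.+ m) !!)  ≡⟨ ℤₚ.pos-* (suc (suc (m ℕ.+ m))) ((m ℕ.+ m) !!) ⟩
  + suc (suc (m ℕ.+ m)) * + ((m ℕ.+ m) !!)
    ≡⟨ cong₂ _*_ (cong (λ k → + suc k) (sym (ℕₚ.+-suc m m))) (!!-as-∏ m) ⟩
  even-number m * ∏[ i < m ] even-number i  ≡⟨ ℤₚ.*-comm (even-number m) _ ⟩
  ∏[ i < suc m ] even-number i              ∎
  where open ≡-Reasoning

alternating-even : ∀ t → alternating (t ℕ.+ t) ≡ - + suc (t ℕ.+ t)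
alternating-even t = trans (cong (λ s → -1ℤ * s * + suc (t ℕ.+ t)) (-1^[n+n]≡1 t))
                           (ℤₚ.-1*i≡-i (+ suc (t ℕ.+ t)))

alternating-odd : ∀ t → alternating (suc (t ℕ.+ t)) ≡ even-number t
alternating-odd t = begin
  -1ℤ * (-1ℤ * -1ℤ ^ (t ℕ.+ t)) * + suc (suc (t ℕ.+ t))
    ≡⟨ cong (λ s → -1ℤ * (-1ℤ * s) * + suc (suc (t ℕ.+ t))) (-1^[n+n]≡1 t) ⟩
  1ℤ * + suc (suc (t ℕ.+ t))  ≡⟨ ℤₚ.*-identityˡ _ ⟩
  + suc (suc (t ℕ.+ t))       ≡⟨ cong (λ k → + suc k) (ℕₚ.+-suc t t) ⟨
  even-number t               ∎
  where open ≡-Reasoning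

alternating-pair : ∀ {m} t w → suc t ℕ.+ w ≡ m →
                   alternating (t ℕ.+ t) * alternating (suc (t ℕ.+ t))
                     ≡ even-number t * even-number w mod suc (m ℕ.+ m)
alternating-pair t w refl = begin
  alternating (t ℕ.+ t) * alternating (suc (t ℕ.+ t))
    ≡⟨ cong₂ _*_ (alternating-even t) (alternating-odd t) ⟩
  - + suc (t ℕ.+ t) * even-number t
    ≈⟨ mod-*ʳ (even-number t) (mod-sym (complement≡neg (suc (t ℕ.+ t)) (odd+even≡p t w))) ⟩
  even-number w * even-number t
    ≡⟨ ℤₚ.*-comm (even-number w) (even-number t) ⟩
  even-number t * even-number w
    ∎
  where
  open ≡-mod-Reasoning (suc (suc t ℕ.+ w ℕ.+ (suc t ℕ.+ w)))
  odd+even≡p : ∀ t w → suc (t ℕ.+ t) ℕ.+ (suc w ℕ.+ suc w) ≡ suc (suc t ℕ.+ w ℕ.+ (suc t ℕ.+ w))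
  odd+even≡p = NatSolver.solve-∀

data EvenOrOdd : ℕ → Set where
  even : ∀ r → EvenOrOdd (r ℕ.+ r)
  odd  : ∀ r → EvenOrOdd (suc (r ℕ.+ r))

evenOrOdd : ∀ n → EvenOrOdd n
evenOrOdd zero    = even 0
evenOrOdd (suc n) with evenOrOdd n
... | even r = odd r
... | odd r  = subst EvenOrOdd (cong suc (ℕₚ.+-suc r r)) (even (suc r))

∏-alternating≡∏-even : ∀ m →
                       ∏[ i < m ] alternating i ≡ ∏[ i < m ] even-number i mod suc (m ℕ.+ m)
∏-alternating≡∏-even m with evenOrOdd m
... | even r = begin
  ∏ (r ℕ.+ r) alternating
    ≡⟨ ∏-pairs r alternating ⟩
  ∏[ t < r ] (alternating (t ℕ.+ t) * alternating (suc (t ℕ.+ t)))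
    ≈⟨ ∏-cong-mod r (λ {t} t<r → alternating-pair t _ (ℕₚ.m+[n∸m]≡n (1+t≤r+r t<r))) ⟩
  ∏[ t < r ] (even-number t * even-number (r ℕ.+ r ∸ suc t))
    ≡⟨ ∏-fold-even r even-number ⟨
  ∏ (r ℕ.+ r) even-number
    ∎
  where
  open ≡-mod-Reasoning (suc (m ℕ.+ m))
  1+t≤r+r : ∀ {t} → t < r → suc t ≤ r ℕ.+ r
  1+t≤r+r t<r = ℕₚ.≤-trans t<r (ℕₚ.m≤m+n r r)
... | odd r = begin
  ∏ (r ℕ.+ r) alternating * alternating (r ℕ.+ r)
    ≡⟨ cong (_* alternating (r ℕ.+ r)) (∏-pairs r alternating) ⟩
  ∏[ t < r ] (alternating (t ℕ.+ t) * alternating (suc (t ℕ.+ t))) * alternating (r ℕ.+ r)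
    ≈⟨ mod-* (∏-cong-mod r (λ {t} t<r → alternating-pair t _ (1+t+[r+r∸t]≡1+r+r t<r))) middle ⟩
  ∏[ t < r ] (even-number t * even-number (r ℕ.+ r ∸ t)) * even-number r
    ≡⟨ ∏-fold-odd r even-number ⟨
  ∏ (suc (r ℕ.+ r)) even-number
    ∎
  where
  open ≡-mod-Reasoning (suc (m ℕ.+ m))
  1+t+[r+r∸t]≡1+r+r : ∀ {t} → t < r → suc t ℕ.+ (r ℕ.+ r ∸ t) ≡ suc (r ℕ.+ r)
  1+t+[r+r∸t]≡1+r+r t<r = cong suc (ℕₚ.m+[n∸m]≡n (ℕₚ.≤-trans (ℕₚ.<⇒≤ t<r) (ℕₚ.m≤m+n r r)))
  odd+even≡p : ∀ r → suc (r ℕ.+ r) ℕ.+ (suc r ℕ.+ suc r) ≡ suc (suc (r ℕ.+ r) ℕ.+ suc (r ℕ.+ r))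
  odd+even≡p = NatSolver.solve-∀
  middle : alternating (r ℕ.+ r) ≡ even-number r mod suc (m ℕ.+ m)
  middle = begin
    alternating (r ℕ.+ r)  ≡⟨ alternating-even r ⟩
    - + suc (r ℕ.+ r)      ≈⟨ mod-sym (complement≡neg (suc (r ℕ.+ r)) (odd+even≡p r)) ⟩
    even-number r          ∎

H≡±!! : ∀ m → Prime (suc (m ℕ.+ m)) →
        + H (m ℕ.+ m) ≡ -1ℤ ^ m * + ((m ℕ.+ m) !!) mod suc (m ℕ.+ m)
H≡±!! m pr = begin
  + H (m ℕ.+ m)                 ≈⟨ H≡∏-alternating m pr ⟩
  ∏[ i < m ] (- alternating i)  ≡⟨ ∏-neg m alternating ⟩
  -1ℤ ^ m * ∏ m alternating     ≈⟨ mod-*ˡ (-1ℤ ^ m) (∏-alternating≡∏-even m) ⟩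
  -1ℤ ^ m * ∏ m even-number     ≡⟨ cong (-1ℤ ^ m *_) (!!-as-∏ m) ⟨
  -1ℤ ^ m * + ((m ℕ.+ m) !!)    ∎
  where open ≡-mod-Reasoning (suc (m ℕ.+ m))

even-prime≡2 : ∀ r → Prime (r ℕ.+ r) → r ℕ.+ r ≡ 2
even-prime≡2 r pr
  with prime⇒irreducible pr (divides r (trans (cong (r ℕ.+_) (sym (ℕₚ.+-identityʳ r)))
                                               (ℕₚ.*-comm 2 r)))
... | inj₁ ()
... | inj₂ 2≡r+r = sym 2≡r+r

theorem5p5 : (p : ℕ) → Prime p → p ≢ 2 →
    (+ p) ∣ ((+ H (p ∸ 1)) - ((- (+ 1)) ^ ⌊ p ∸ 1 /2⌋) * (+ ((p ∸ 1) !!)))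
theorem5p5 p p-prime p≢2 with evenOrOdd p
... | even r = contradiction (even-prime≡2 r p-prime) p≢2
... | odd m rewrite sym (ℕₚ.n≡⌊n+n/2⌋ m) =
  Signed.∣⇒∣ᵤ (difference-divisible (H≡±!! m p-prime))
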